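{- For all natural numbers $n,k$ with $n\ge k$, the positive integer $c_{n,k}$ is a multiple of the rational number $\frac{q_{n,k}}{k!}$; that is, $\dfrac{k!\,c_{n,k}}{q_{n,k}}$ is an integer.
   Context: An integer-valued polynomial is a polynomial $P\in\mathbb{C}[X]$ with $P(\mathbb{Z})\subset\mathbb{Z}$; $E_n$ is the set of integer-valued polynomials of degree $\le n$. $c_{n,k}$ is the smallest positive integer such that $c_{n,k}P^{(k)}\in E_n$ for every $P\in E_n$ (where $P^{(k)}$ is the $k$-th derivative). For $n\ge k$, $$q_{n,k} = \mathrm{lcm}\{i_1 i_2\cdots i_k \mid i_1,\dots,i_k \text{ positive integers},\ i_1+\dots+i_k\le n\},$$ with the convention $q_{n,0}=1$. -}

module Defs where

open import Data.Nat as ℕ using (ℕ; zero; suc; _≤_; _∸_)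
open import Data.Nat.LCM using (lcm)
open import Data.Integer as ℤ using (ℤ; +_)
open import Data.Rational as ℚ using (ℚ; _/_)
open import Data.List using (List; []; _∷_; length; map; foldr; concatMap; upTo)
open import Data.Product using (Σ; ∃; _×_)
open import Function using (_∘_)
open import Relation.Binary.PropositionalEquality using (_≡_)

-- A polynomial with rational coefficients, as the list of its
-- coefficients [a₀, a₁, …, a_d] (lowest degree first).
Poly : Set
Poly = List ℚ

eval : Poly → ℚ → ℚ
eval P x = foldr (λ a acc → a ℚ.+ x ℚ.* acc) ℚ.0ℚ P

ι : ℤ → ℚ
ι m = m / 1

IsInteger : ℚ → Set
IsInteger r = Σ ℤ λ m → r ≡ ι m

IntegerValued : Poly → Set
IntegerValued P = (z : ℤ) → IsInteger (eval P (ι z))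

DegLe : ℕ → Poly → Set
DegLe n P = length P ≤ suc n

InE : ℕ → Poly → Set
InE n P = DegLe n P × IntegerValued P

derivAux : ℕ → Poly → Poly
derivAux m []       = []
derivAux m (a ∷ as) = (ι (+ m) ℚ.* a) ∷ derivAux (suc m) as

deriv : Poly → Poly
deriv []       = []
deriv (a ∷ as) = derivAux 1 as

derivⁿ : ℕ → Poly → Poly
derivⁿ zero    P = P
derivⁿ (suc k) P = deriv (derivⁿ k P)

scale : ℕ → Poly → Poly
scale c = map (ι (+ c) ℚ.*_)

Good : ℕ → ℕ → ℕ → Set
Good n k c = (P : Poly) → InE n P → InE n (scale c (derivⁿ k P))

IsC : ℕ → ℕ → ℕ → Set
IsC n k c = (0 ℕ.< c) × Good n k c × ((d : ℕ) → 0 ℕ.< d → Good n k d → c ℕ.≤ d)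

-- products : the list of all products i₁⋯i_k over k-tuples of positive
-- integers (i₁,…,i_k) with i₁+⋯+i_k ≤ n  (for k = 0: the empty product 1)
products : ℕ → ℕ → List ℕ
products n zero    = 1 ∷ []
products n (suc k) = concatMap (λ j → map (suc j ℕ.*_) (products (n ∸ suc j) k)) (upTo n)

q : ℕ → ℕ → ℕ
q n k = foldr lcm 1 (products n k)

{-# OPTIONS --safe #-}
module Submission where

-- For positive integers i₁, …, i_k with i₁ + ⋯ + i_k ≤ n, the polynomial
-- P = ∏ᵣ C(X + iᵣ - 1, iᵣ) lies in E_n, and since C(X + i - 1, i) = X/i + O(X²)
-- its lowest term is Xᵏ/(i₁⋯i_k). So c_{n,k} P⁽ᵏ⁾(0) = c_{n,k} k!/(i₁⋯i_k) is an
-- integer: every such product i₁⋯i_k divides k! c_{n,k}, hence so does their lcm.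

open import Defs
open import Data.Nat using (ℕ; zero; suc; _+_; _*_; _∸_; _⊔_; _≤_; _<_; _!; z≤n; s≤s)
import Data.Nat.Properties as ℕ
open import Data.Nat.Divisibility using (_∣_; divides; 1∣_)
open import Data.Nat.LCM using (lcm; lcm-least)
import Data.Nat.Coprimality as Coprimality
open import Data.Integer as ℤ using (ℤ; +_; -[1+_])
import Data.Integer.Properties as ℤ
open import Data.Rational as ℚ using (ℚ; mkℚ; 0ℚ; 1ℚ; 1/_)
import Data.Rational.Properties as ℚ
open import Data.Rational.Solver using (module +-*-Solver)
open import Data.List using (List; []; _∷_; length; map; foldr)
open import Data.Nat.ListAction using (sum; product)
import Data.List.Properties as List
open import Data.List.Relation.Unary.All using (All; []; _∷_)
import Data.List.Relation.Unary.All.Properties as All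
open import Data.Product using (_,_; _×_; proj₂)
open import Relation.Binary.PropositionalEquality
open ≡-Reasoning
open +-*-Solver

integerℚ : ℤ → ℚ
integerℚ m = mkℚ m 0 (Coprimality.sym (Coprimality.1-coprimeTo ℤ.∣ m ∣))

ι≡integerℚ : ∀ m → ι m ≡ integerℚ m
ι≡integerℚ m = ℚ.↥p/↧p≡p (integerℚ m)

ι-+ : ∀ a b → ι (a ℤ.+ b) ≡ ι a ℚ.+ ι b
ι-+ a b rewrite ι≡integerℚ a | ι≡integerℚ b =
  cong₂ (λ u v → (u ℤ.+ v) ℚ./ 1) (sym (ℤ.*-identityʳ a)) (sym (ℤ.*-identityʳ b))

ι-* : ∀ a b → ι (a ℤ.* b) ≡ ι a ℚ.* ι b
ι-* a b rewrite ι≡integerℚ a | ι≡integerℚ b = refl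

ι-neg : ∀ a → ι (ℤ.- a) ≡ ℚ.- ι a
ι-neg a rewrite ι≡integerℚ (ℤ.- a) | ι≡integerℚ a = neg a
  where
  neg : ∀ a → integerℚ (ℤ.- a) ≡ ℚ.- integerℚ a
  neg (+ zero)  = refl
  neg (+ suc n) = refl
  neg -[1+ n ]  = refl

ι-injective : ∀ {a b} → ι a ≡ ι b → a ≡ b
ι-injective {a} {b} eq rewrite ι≡integerℚ a | ι≡integerℚ b = cong ℚ.↥_ eq

ιℕ : ℕ → ℚ
ιℕ m = ι (+ m)

ιℕ-* : ∀ a b → ιℕ (a * b) ≡ ιℕ a ℚ.* ιℕ b
ιℕ-* a b = trans (cong ι (ℤ.pos-* a b)) (ι-* (+ a) (+ b))

ιℕ-suc : ∀ t → ιℕ (suc t) ≡ 1ℚ ℚ.+ ιℕ t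
ιℕ-suc t = ι-+ (+ 1) (+ t)

IsInteger-+ : ∀ {a b} → IsInteger a → IsInteger b → IsInteger (a ℚ.+ b)
IsInteger-+ (m , refl) (n , refl) = m ℤ.+ n , sym (ι-+ m n)

IsInteger-* : ∀ {a b} → IsInteger a → IsInteger b → IsInteger (a ℚ.* b)
IsInteger-* (m , refl) (n , refl) = m ℤ.* n , sym (ι-* m n)

IsInteger-cancelʳ : ∀ a b → IsInteger (a ℚ.+ b) → IsInteger b → IsInteger a
IsInteger-cancelʳ a b (m , a+b≡m) (n , refl) = m ℤ.- n , (begin
  a                     ≡⟨ solve 2 (λ a b → a := (a :+ b) :+ (:- b)) refl a b ⟩
  (a ℚ.+ b) ℚ.- ι n     ≡⟨ cong₂ ℚ._+_ a+b≡m (sym (ι-neg n)) ⟩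
  ι m ℚ.+ ι (ℤ.- n)     ≡⟨ sym (ι-+ m (ℤ.- n)) ⟩
  ι (m ℤ.- n)           ∎)

ℤ-induction : (P : ℤ → Set) → P (+ 0) →
              (∀ z → P z → P (z ℤ.+ + 1)) → (∀ z → P (z ℤ.+ + 1) → P z) →
              ∀ z → P z
ℤ-induction P p₀ up down (+ zero)       = p₀
ℤ-induction P p₀ up down (+ suc n)      =
  subst P (cong +_ (ℕ.+-comm n 1)) (up (+ n) (ℤ-induction P p₀ up down (+ n)))
ℤ-induction P p₀ up down -[1+ zero ]    = down _ p₀
ℤ-induction P p₀ up down -[1+ suc n ]   = down _ (ℤ-induction P p₀ up down -[1+ n ])

∣-fromℚ : ∀ m d r → r ℚ.* ιℕ d ≡ 1ℚ → IsInteger (ιℕ m ℚ.* r) → d ∣ m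
∣-fromℚ m d r r·d≡1 (z , m·r≡z) = divides ℤ.∣ z ∣ (begin
  m                    ≡⟨ cong ℤ.∣_∣ (ι-injective {+ m} {z ℤ.* + d} ιm≡ιzd) ⟩
  ℤ.∣ z ℤ.* + d ∣      ≡⟨ ℤ.abs-* z (+ d) ⟩
  ℤ.∣ z ∣ * d          ∎)
  where
  ιm≡ιzd : ιℕ m ≡ ι (z ℤ.* + d)
  ιm≡ιzd = begin
    ιℕ m                         ≡⟨ sym (ℚ.*-identityʳ (ιℕ m)) ⟩
    ιℕ m ℚ.* 1ℚ                  ≡⟨ cong (ιℕ m ℚ.*_) (sym r·d≡1) ⟩
    ιℕ m ℚ.* (r ℚ.* ιℕ d)        ≡⟨ sym (ℚ.*-assoc (ιℕ m) r (ιℕ d)) ⟩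
    (ιℕ m ℚ.* r) ℚ.* ιℕ d        ≡⟨ cong (ℚ._* ιℕ d) m·r≡z ⟩
    ι z ℚ.* ιℕ d                 ≡⟨ sym (ι-* z (+ d)) ⟩
    ι (z ℤ.* + d)                ∎

coeff : ℕ → Poly → ℚ
coeff _       []      = 0ℚ
coeff zero    (a ∷ _) = a
coeff (suc i) (_ ∷ P) = coeff i P

infixl 6 _⊕_
_⊕_ : Poly → Poly → Poly
[]      ⊕ R       = R
(a ∷ P) ⊕ []      = a ∷ P
(a ∷ P) ⊕ (b ∷ R) = (a ℚ.+ b) ∷ (P ⊕ R)

infixr 7 _·_
_·_ : ℚ → Poly → Poly
a · P = map (a ℚ.*_) P

mulLinear : ℚ → ℚ → Poly → Poly
mulLinear a b P = a · P ⊕ (0ℚ ∷ b · P)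

coeff-⊕ : ∀ i P R → coeff i (P ⊕ R) ≡ coeff i P ℚ.+ coeff i R
coeff-⊕ i       []      R       = sym (ℚ.+-identityˡ _)
coeff-⊕ zero    (a ∷ P) []      = sym (ℚ.+-identityʳ _)
coeff-⊕ (suc i) (a ∷ P) []      = sym (ℚ.+-identityʳ _)
coeff-⊕ zero    (a ∷ P) (b ∷ R) = refl
coeff-⊕ (suc i) (a ∷ P) (b ∷ R) = coeff-⊕ i P R

coeff-· : ∀ i a P → coeff i (a · P) ≡ a ℚ.* coeff i P
coeff-· i       a []      = sym (ℚ.*-zeroʳ a)
coeff-· zero    a (x ∷ P) = refl
coeff-· (suc i) a (x ∷ P) = coeff-· i a P

coeff-zero-mulLinear : ∀ a b P → coeff 0 (mulLinear a b P) ≡ a ℚ.* coeff 0 P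
coeff-zero-mulLinear a b P
  rewrite coeff-⊕ 0 (a · P) (0ℚ ∷ b · P) | coeff-· 0 a P = ℚ.+-identityʳ _

coeff-suc-mulLinear : ∀ i a b P →
  coeff (suc i) (mulLinear a b P) ≡ a ℚ.* coeff (suc i) P ℚ.+ b ℚ.* coeff i P
coeff-suc-mulLinear i a b P
  rewrite coeff-⊕ (suc i) (a · P) (0ℚ ∷ b · P) | coeff-· (suc i) a P | coeff-· i b P = refl

eval-⊕ : ∀ P R x → eval (P ⊕ R) x ≡ eval P x ℚ.+ eval R x
eval-⊕ []      R       x = sym (ℚ.+-identityˡ _)
eval-⊕ (a ∷ P) []      x = sym (ℚ.+-identityʳ _)
eval-⊕ (a ∷ P) (b ∷ R) x rewrite eval-⊕ P R x =
  solve 5 (λ a b x p r → (a :+ b) :+ x :* (p :+ r) := (a :+ x :* p) :+ (b :+ x :* r))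
    refl a b x (eval P x) (eval R x)

eval-· : ∀ a P x → eval (a · P) x ≡ a ℚ.* eval P x
eval-· a []      x = sym (ℚ.*-zeroʳ a)
eval-· a (b ∷ P) x rewrite eval-· a P x =
  solve 4 (λ a b x p → a :* b :+ x :* (a :* p) := a :* (b :+ x :* p)) refl a b x (eval P x)

eval-mulLinear : ∀ a b P x → eval (mulLinear a b P) x ≡ (a ℚ.+ b ℚ.* x) ℚ.* eval P x
eval-mulLinear a b P x
  rewrite eval-⊕ (a · P) (0ℚ ∷ b · P) x | eval-· b P x | eval-· a P x =
  solve 4 (λ a b x p → a :* p :+ (con 0ℚ :+ x :* (b :* p)) := (a :+ b :* x) :* p)
    refl a b x (eval P x)

eval-at-0 : ∀ P → eval P 0ℚ ≡ coeff 0 P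
eval-at-0 []      = refl
eval-at-0 (a ∷ P) rewrite ℚ.*-zeroˡ (eval P 0ℚ) = ℚ.+-identityʳ a

length-⊕ : ∀ P R → length (P ⊕ R) ≡ length P ⊔ length R
length-⊕ []      R       = refl
length-⊕ (a ∷ P) []      = refl
length-⊕ (a ∷ P) (b ∷ R) = cong suc (length-⊕ P R)

length-mulLinear : ∀ a b P → length (mulLinear a b P) ≡ suc (length P)
length-mulLinear a b P
  rewrite length-⊕ (a · P) (0ℚ ∷ b · P) | List.length-map (a ℚ.*_) P | List.length-map (b ℚ.*_) P
  = ℕ.m≤n⇒m⊔n≡n (ℕ.n≤1+n (length P))

VanishesBelow : ℕ → Poly → Set
VanishesBelow m P = ∀ i → i < m → coeff i P ≡ 0ℚ

LowestTerm : ℕ → ℚ → Poly → Set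
LowestTerm m r P = VanishesBelow m P × coeff m P ≡ r

lowestTerm-mulLinear : ∀ {m r} a b P → LowestTerm m r P → LowestTerm m (a ℚ.* r) (mulLinear a b P)
lowestTerm-mulLinear {m} {r} a b P (low , lowest) = vanishes , leading m refl
  where
  vanishes : VanishesBelow m (mulLinear a b P)
  vanishes zero    0<m rewrite coeff-zero-mulLinear a b P | low 0 0<m = ℚ.*-zeroʳ a
  vanishes (suc i) i<m rewrite coeff-suc-mulLinear i a b P
    | low (suc i) i<m | low i (ℕ.<-trans (ℕ.n<1+n i) i<m) | ℚ.*-zeroʳ a | ℚ.*-zeroʳ b = refl
  leading : ∀ i → i ≡ m → coeff i (mulLinear a b P) ≡ a ℚ.* r
  leading zero    refl rewrite coeff-zero-mulLinear a b P = cong (a ℚ.*_) lowest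
  leading (suc i) refl rewrite coeff-suc-mulLinear i a b P | low i (ℕ.n<1+n i) | ℚ.*-zeroʳ b
    = trans (ℚ.+-identityʳ _) (cong (a ℚ.*_) lowest)

lowestTerm-mulX : ∀ {m r} b P → LowestTerm m r P → LowestTerm (suc m) (b ℚ.* r) (mulLinear 0ℚ b P)
lowestTerm-mulX {m} {r} b P (low , lowest) = vanishes , leading
  where
  vanishes : VanishesBelow (suc m) (mulLinear 0ℚ b P)
  vanishes zero    _         rewrite coeff-zero-mulLinear 0ℚ b P = ℚ.*-zeroˡ (coeff 0 P)
  vanishes (suc i) (s≤s i<m) rewrite coeff-suc-mulLinear i 0ℚ b P | low i i<m
    | ℚ.*-zeroˡ (coeff (suc i) P) | ℚ.*-zeroʳ b = refl
  leading : coeff (suc m) (mulLinear 0ℚ b P) ≡ b ℚ.* r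
  leading rewrite coeff-suc-mulLinear m 0ℚ b P | ℚ.*-zeroˡ (coeff (suc m) P)
    = trans (ℚ.+-identityˡ _) (cong (b ℚ.*_) lowest)

ascFact : ℕ → ℕ → ℕ
ascFact j zero    = 1
ascFact j (suc k) = suc j * ascFact (suc j) k

ascFact-* : ∀ j k → ascFact j k * j ! ≡ (j + k) !
ascFact-* j zero    rewrite ℕ.+-identityʳ j = ℕ.+-identityʳ _
ascFact-* j (suc k) rewrite ℕ.+-suc j k = begin
  suc j * ascFact (suc j) k * j !   ≡⟨ ℕ.*-assoc (suc j) (ascFact (suc j) k) (j !) ⟩
  suc j * (ascFact (suc j) k * j !) ≡⟨ ℕ.*-comm (suc j) _ ⟩
  ascFact (suc j) k * j ! * suc j   ≡⟨ ℕ.*-assoc (ascFact (suc j) k) (j !) (suc j) ⟩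
  ascFact (suc j) k * (j ! * suc j) ≡⟨ cong (ascFact (suc j) k *_) (ℕ.*-comm (j !) (suc j)) ⟩
  ascFact (suc j) k * suc j !       ≡⟨ ascFact-* (suc j) k ⟩
  (suc j + k) !                     ∎

ascFact-zero : ∀ k → ascFact 0 k ≡ k !
ascFact-zero k = trans (sym (ℕ.*-identityʳ (ascFact 0 k))) (ascFact-* 0 k)

coeff-derivAux : ∀ j m P → coeff j (derivAux m P) ≡ ιℕ (m + j) ℚ.* coeff j P
coeff-derivAux j       m []      = sym (ℚ.*-zeroʳ (ιℕ (m + j)))
coeff-derivAux zero    m (a ∷ P) rewrite ℕ.+-identityʳ m = refl
coeff-derivAux (suc j) m (a ∷ P) rewrite ℕ.+-suc m j = coeff-derivAux j (suc m) P

coeff-deriv : ∀ j P → coeff j (deriv P) ≡ ιℕ (suc j) ℚ.* coeff (suc j) P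
coeff-deriv j []      = sym (ℚ.*-zeroʳ (ιℕ (suc j)))
coeff-deriv j (a ∷ P) = coeff-derivAux j 1 P

coeff-derivⁿ : ∀ k j P → coeff j (derivⁿ k P) ≡ ιℕ (ascFact j k) ℚ.* coeff (j + k) P
coeff-derivⁿ zero    j P rewrite ℕ.+-identityʳ j = sym (ℚ.*-identityˡ _)
coeff-derivⁿ (suc k) j P
  rewrite coeff-deriv j (derivⁿ k P) | coeff-derivⁿ k (suc j) P
        | ιℕ-* (suc j) (ascFact (suc j) k) | ℕ.+-suc j k
  = sym (ℚ.*-assoc (ιℕ (suc j)) (ιℕ (ascFact (suc j) k)) (coeff (suc (j + k)) P))

derivⁿ-at-0 : ∀ k P → eval (derivⁿ k P) 0ℚ ≡ ιℕ (k !) ℚ.* coeff k P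
derivⁿ-at-0 k P = begin
  eval (derivⁿ k P) 0ℚ                 ≡⟨ eval-at-0 (derivⁿ k P) ⟩
  coeff 0 (derivⁿ k P)                 ≡⟨ coeff-derivⁿ k 0 P ⟩
  ιℕ (ascFact 0 k) ℚ.* coeff k P       ≡⟨ cong (λ m → ιℕ m ℚ.* coeff k P) (ascFact-zero k) ⟩
  ιℕ (k !) ℚ.* coeff k P               ∎

recip : ℕ → ℚ
recip t = 1/ integerℚ (+ suc t)

ιℕ-*-recip : ∀ t → ιℕ (suc t) ℚ.* recip t ≡ 1ℚ
ιℕ-*-recip t rewrite ι≡integerℚ (+ suc t) = ℚ.*-inverseʳ (integerℚ (+ suc t))

mulBinomial : ℕ → Poly → Poly
mulBinomial zero    P = P
mulBinomial (suc t) P = mulLinear (ιℕ t ℚ.* recip t) (recip t) (mulBinomial t P)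

-- binomial t x = C(x + t - 1, t)
binomial : ℕ → ℚ → ℚ
binomial zero    x = 1ℚ
binomial (suc t) x = recip t ℚ.* (x ℚ.+ ιℕ t) ℚ.* binomial t x

eval-mulBinomial : ∀ t P x → eval (mulBinomial t P) x ≡ binomial t x ℚ.* eval P x
eval-mulBinomial zero    P x = sym (ℚ.*-identityˡ (eval P x))
eval-mulBinomial (suc t) P x
  rewrite eval-mulLinear (ιℕ t ℚ.* recip t) (recip t) (mulBinomial t P) x | eval-mulBinomial t P x
  = solve 5 (λ i c x b e → (i :* c :+ c :* x) :* (b :* e) := c :* (x :+ i) :* b :* e)
      refl (ιℕ t) (recip t) x (binomial t x) (eval P x)

length-mulBinomial : ∀ t P → length (mulBinomial t P) ≡ t + length P
length-mulBinomial zero    P = refl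
length-mulBinomial (suc t) P =
  trans (length-mulLinear (ιℕ t ℚ.* recip t) (recip t) (mulBinomial t P)) (cong suc (length-mulBinomial t P))

-- The first factor is X itself, and each further factor (X + s)/(s + 1) scales
-- the lowest coefficient by s/(s + 1); the product telescopes to 1/(t + 1).
lowestTerm-mulBinomial : ∀ {m r} t P → LowestTerm m r P →
                         LowestTerm (suc m) (recip t ℚ.* r) (mulBinomial (suc t) P)
lowestTerm-mulBinomial {m} {r} zero P lowest =
  subst (λ a → LowestTerm (suc m) (recip 0 ℚ.* r) (mulLinear a (recip 0) P)) (sym (ℚ.*-zeroˡ (recip 0)))
    (lowestTerm-mulX (recip 0) P lowest)
lowestTerm-mulBinomial {m} {r} (suc t) P lowest =
  subst (λ s → LowestTerm (suc m) s (mulBinomial (suc (suc t)) P)) telescope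
    (lowestTerm-mulLinear a (recip (suc t)) (mulBinomial (suc t) P) (lowestTerm-mulBinomial t P lowest))
  where
  a = ιℕ (suc t) ℚ.* recip (suc t)
  telescope : a ℚ.* (recip t ℚ.* r) ≡ recip (suc t) ℚ.* r
  telescope = begin
    a ℚ.* (recip t ℚ.* r)
      ≡⟨ solve 4 (λ i c c′ r → i :* c′ :* (c :* r) := c′ :* (i :* c) :* r)
           refl (ιℕ (suc t)) (recip t) (recip (suc t)) r ⟩
    recip (suc t) ℚ.* (ιℕ (suc t) ℚ.* recip t) ℚ.* r
      ≡⟨ cong (λ u → recip (suc t) ℚ.* u ℚ.* r) (ιℕ-*-recip t) ⟩
    recip (suc t) ℚ.* 1ℚ ℚ.* r
      ≡⟨ cong (ℚ._* r) (ℚ.*-identityʳ (recip (suc t))) ⟩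
    recip (suc t) ℚ.* r ∎

binomial-shift : ∀ t x → x ℚ.* binomial t (x ℚ.+ 1ℚ) ≡ (x ℚ.+ ιℕ t) ℚ.* binomial t x
binomial-shift zero    x = solve 1 (λ x → x :* con 1ℚ := (x :+ con 0ℚ) :* con 1ℚ) refl x
binomial-shift (suc t) x = begin
  x ℚ.* (c ℚ.* ((x ℚ.+ 1ℚ) ℚ.+ s) ℚ.* B₁)
    ≡⟨ solve 4 (λ x c s B₁ → x :* (c :* ((x :+ con 1ℚ) :+ s) :* B₁) := c :* ((x :+ con 1ℚ) :+ s) :* (x :* B₁))
         refl x c s B₁ ⟩
  c ℚ.* ((x ℚ.+ 1ℚ) ℚ.+ s) ℚ.* (x ℚ.* B₁)
    ≡⟨ cong (c ℚ.* ((x ℚ.+ 1ℚ) ℚ.+ s) ℚ.*_) (binomial-shift t x) ⟩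
  c ℚ.* ((x ℚ.+ 1ℚ) ℚ.+ s) ℚ.* ((x ℚ.+ s) ℚ.* B₀)
    ≡⟨ solve 4 (λ x c s B₀ → c :* ((x :+ con 1ℚ) :+ s) :* ((x :+ s) :* B₀) := (x :+ (con 1ℚ :+ s)) :* (c :* (x :+ s) :* B₀))
         refl x c s B₀ ⟩
  (x ℚ.+ (1ℚ ℚ.+ s)) ℚ.* (c ℚ.* (x ℚ.+ s) ℚ.* B₀)
    ≡⟨ cong (λ u → (x ℚ.+ u) ℚ.* binomial (suc t) x) (sym (ιℕ-suc t)) ⟩
  (x ℚ.+ ιℕ (suc t)) ℚ.* binomial (suc t) x ∎
  where
  c = recip t
  s = ιℕ t
  B₁ = binomial t (x ℚ.+ 1ℚ)
  B₀ = binomial t x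

binomial-pascal : ∀ t x → binomial (suc t) (x ℚ.+ 1ℚ) ≡ binomial (suc t) x ℚ.+ binomial t (x ℚ.+ 1ℚ)
binomial-pascal t x = begin
  c ℚ.* ((x ℚ.+ 1ℚ) ℚ.+ s) ℚ.* B₁
    ≡⟨ solve 4 (λ x c s B₁ → c :* ((x :+ con 1ℚ) :+ s) :* B₁ := c :* (x :* B₁) :+ ((con 1ℚ :+ s) :* c) :* B₁)
         refl x c s B₁ ⟩
  c ℚ.* (x ℚ.* B₁) ℚ.+ ((1ℚ ℚ.+ s) ℚ.* c) ℚ.* B₁
    ≡⟨ cong₂ (λ u v → c ℚ.* u ℚ.+ v ℚ.* B₁)
         (binomial-shift t x) (trans (cong (ℚ._* c) (sym (ιℕ-suc t))) (ιℕ-*-recip t)) ⟩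
  c ℚ.* ((x ℚ.+ s) ℚ.* B₀) ℚ.+ 1ℚ ℚ.* B₁
    ≡⟨ cong₂ ℚ._+_ (sym (ℚ.*-assoc c (x ℚ.+ s) B₀)) (ℚ.*-identityˡ B₁) ⟩
  binomial (suc t) x ℚ.+ B₁ ∎
  where
  c = recip t
  s = ιℕ t
  B₁ = binomial t (x ℚ.+ 1ℚ)
  B₀ = binomial t x

binomial-at-0 : ∀ t → binomial (suc t) 0ℚ ≡ 0ℚ
binomial-at-0 zero    = solve 1 (λ c → c :* (con 0ℚ :+ con 0ℚ) :* con 1ℚ := con 0ℚ) refl (recip 0)
binomial-at-0 (suc t) rewrite binomial-at-0 t = ℚ.*-zeroʳ (recip (suc t) ℚ.* (0ℚ ℚ.+ ιℕ (suc t)))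

binomial-integer : ∀ t z → IsInteger (binomial t (ι z))
binomial-integer zero    z = + 1 , refl
binomial-integer (suc t)   = ℤ-induction (λ z → IsInteger (B (ι z))) (+ 0 , binomial-at-0 t) up down
  where
  B = binomial (suc t)
  ι-suc : ∀ z → ι (z ℤ.+ + 1) ≡ ι z ℚ.+ 1ℚ
  ι-suc z = ι-+ z (+ 1)
  previous : ∀ z → IsInteger (binomial t (ι z ℚ.+ 1ℚ))
  previous z = subst (λ x → IsInteger (binomial t x)) (ι-suc z) (binomial-integer t (z ℤ.+ + 1))
  up : ∀ z → IsInteger (B (ι z)) → IsInteger (B (ι (z ℤ.+ + 1)))
  up z h = subst IsInteger (sym (trans (cong B (ι-suc z)) (binomial-pascal t (ι z))))
             (IsInteger-+ h (previous z))
  down : ∀ z → IsInteger (B (ι (z ℤ.+ + 1))) → IsInteger (B (ι z))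
  down z h = IsInteger-cancelʳ (B (ι z)) _
               (subst IsInteger (trans (cong B (ι-suc z)) (binomial-pascal t (ι z))) h) (previous z)

-- For parts i₁, …, i_k (encoded as jᵣ = iᵣ - 1), the product ∏ᵣ C(X + iᵣ - 1, iᵣ).
testPoly : List ℕ → Poly
testPoly []       = 1ℚ ∷ []
testPoly (j ∷ js) = mulBinomial (suc j) (testPoly js)

length-testPoly : ∀ js → length (testPoly js) ≡ suc (sum (map suc js))
length-testPoly []       = refl
length-testPoly (j ∷ js) = begin
  length (mulBinomial (suc j) (testPoly js))   ≡⟨ length-mulBinomial (suc j) (testPoly js) ⟩
  suc j + length (testPoly js)                 ≡⟨ cong (λ m → suc j + m) (length-testPoly js) ⟩
  suc j + suc (sum (map suc js))               ≡⟨ ℕ.+-suc (suc j) _ ⟩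
  suc (sum (map suc (j ∷ js)))                 ∎

testPoly-integerValued : ∀ js → IntegerValued (testPoly js)
testPoly-integerValued []       z = + 1 , trans (cong (1ℚ ℚ.+_) (ℚ.*-zeroʳ (ι z))) (ℚ.+-identityʳ 1ℚ)
testPoly-integerValued (j ∷ js) z =
  subst IsInteger (sym (eval-mulBinomial (suc j) (testPoly js) (ι z)))
    (IsInteger-* (binomial-integer (suc j) z) (testPoly-integerValued js z))

testPoly-∈E : ∀ {n} js → sum (map suc js) ≤ n → InE n (testPoly js)
testPoly-∈E js sum≤n =
  subst (_≤ _) (sym (length-testPoly js)) (s≤s sum≤n) , testPoly-integerValued js

recips : List ℕ → ℚ
recips []       = 1ℚ
recips (j ∷ js) = recip j ℚ.* recips js

lowestTerm-testPoly : ∀ js → LowestTerm (length js) (recips js) (testPoly js)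
lowestTerm-testPoly []       = (λ _ ()) , refl
lowestTerm-testPoly (j ∷ js) = lowestTerm-mulBinomial j (testPoly js) (lowestTerm-testPoly js)

recips-* : ∀ js → recips js ℚ.* ιℕ (product (map suc js)) ≡ 1ℚ
recips-* []       = ℚ.*-identityˡ 1ℚ
recips-* (j ∷ js) = begin
  recip j ℚ.* R ℚ.* ιℕ (suc j * M)               ≡⟨ cong (recip j ℚ.* R ℚ.*_) (ιℕ-* (suc j) M) ⟩
  recip j ℚ.* R ℚ.* (ιℕ (suc j) ℚ.* ιℕ M)
    ≡⟨ solve 4 (λ c r u m → c :* r :* (u :* m) := (u :* c) :* (r :* m)) refl (recip j) R (ιℕ (suc j)) (ιℕ M) ⟩
  (ιℕ (suc j) ℚ.* recip j) ℚ.* (R ℚ.* ιℕ M)      ≡⟨ cong₂ ℚ._*_ (ιℕ-*-recip j) (recips-* js) ⟩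
  1ℚ ℚ.* 1ℚ                                     ≡⟨ ℚ.*-identityˡ 1ℚ ⟩
  1ℚ                                            ∎
  where
  R = recips js
  M = product (map suc js)

-- Read off from the value of c · P⁽ᵏ⁾ at 0.
good⇒integer-coeff : ∀ n k c → Good n k c → ∀ P → InE n P → IsInteger (ιℕ (k ! * c) ℚ.* coeff k P)
good⇒integer-coeff n k c good P P∈E with good P P∈E
... | _ , integerValued with integerValued (+ 0)
... | z , value≡z = z , (begin
  ιℕ (k ! * c) ℚ.* coeff k P                 ≡⟨ cong (ℚ._* coeff k P) (ιℕ-* (k !) c) ⟩
  ιℕ (k !) ℚ.* ιℕ c ℚ.* coeff k P
    ≡⟨ solve 3 (λ f c p → f :* c :* p := c :* (f :* p)) refl (ιℕ (k !)) (ιℕ c) (coeff k P) ⟩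
  ιℕ c ℚ.* (ιℕ (k !) ℚ.* coeff k P)          ≡⟨ cong (ιℕ c ℚ.*_) (sym (derivⁿ-at-0 k P)) ⟩
  ιℕ c ℚ.* eval (derivⁿ k P) 0ℚ              ≡⟨ sym (eval-· (ιℕ c) (derivⁿ k P) 0ℚ) ⟩
  eval (scale c (derivⁿ k P)) 0ℚ             ≡⟨ value≡z ⟩
  ι z                                        ∎)

product-∣ : ∀ n k c → Good n k c → ∀ js → length js ≡ k → sum (map suc js) ≤ n →
            product (map suc js) ∣ k ! * c
product-∣ n k c good js refl sum≤n =
  ∣-fromℚ (k ! * c) _ (recips js) (recips-* js)
    (subst (λ r → IsInteger (ιℕ (k ! * c) ℚ.* r)) (proj₂ (lowestTerm-testPoly js))
      (good⇒integer-coeff n k c good (testPoly js) (testPoly-∈E js sum≤n)))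

All-products : (F : ℕ → Set) → ∀ k n →
               (∀ js → length js ≡ k → sum (map suc js) ≤ n → F (product (map suc js))) →
               All F (products n k)
All-products F zero    n h = h [] refl z≤n ∷ []
All-products F (suc k) n h = All.concat⁺ (All.map⁺ (All.applyUpTo⁺₁ _ n first))
  where
  first : ∀ {j} → j < n → All F (map (suc j *_) (products (n ∸ suc j) k))
  first {j} j<n = All.map⁺ (All-products (λ m → F (suc j * m)) k (n ∸ suc j)
    (λ js len sum≤ → h (j ∷ js) (cong suc len)
       (subst (suc j + sum (map suc js) ≤_) (ℕ.m+[n∸m]≡n j<n) (ℕ.+-monoʳ-≤ (suc j) sum≤))))

foldr-lcm-least : ∀ {m} xs → All (_∣ m) xs → foldr lcm 1 xs ∣ m
foldr-lcm-least []       []         = 1∣ _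
foldr-lcm-least (x ∷ xs) (x∣m ∷ xs∣m) = lcm-least x∣m (foldr-lcm-least xs xs∣m)

theorem3 : (n k c : ℕ) → k ≤ n → IsC n k c → q n k ∣ (k !) * c
theorem3 n k c _ (_ , good , _) =
  foldr-lcm-least (products n k) (All-products (_∣ k ! * c) k n (product-∣ n k c good))
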